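{- Let $(X,\nu,\mathcal{T}_1,\tau_1)$ be a Type 1 computable topological space which satisfies the Markov condition with respect to effective closure: $$\forall x\in X,\ \forall A\subseteq X,\ \big(x\notin A\ \&\ x\in\overline{A}^{+}\big)\implies A\rightsquigarrow_\nu\{x\},$$ and let $(Y,\mu,\mathcal{T}_2,\tau_2)$ be any Type 1 computable topological space. Then no $(\nu,\mu)$-computable function $f:X\to Y$ has an effective discontinuity at any point $x\in X$; that is, there is no $x\in X$ and effective open set $O_2$ of $Y$ with $x\in f^{ -1}(O_2)\cap\overline{(f^{ -1}(O_2))^{c}}^{+}$.
   Context: A numbering of a set $X$ is a surjection $\nu$ from a subset $\mathrm{dom}(\nu)\subseteq\mathbb{N}$ onto $X$; a subnumbering of $X$ is a numbering of a subset of $X$. If $\nu(n)=x$, $n$ is a $\nu$-name of $x$. $\varphi_0,\varphi_1,\dots$ is a standard enumeration of the partial recursive functions. For numbered sets $(X,\nu),(Y,\mu)$, a map $f:X\to Y$ is $(\nu,\mu)$-computable if there is a partial computable $F$ defined on $\mathrm{dom}(\nu)$ with $\mu(F(n))=f(\nu(n))$ for all $n\in\mathrm{dom}(\nu)$. A set $A\subseteq X$ is $\nu$-semi-decidable if there is $e$ with $\varphi_e(i)\downarrow\iff\nu(i)\in A$ for all $i\in\mathrm{dom}(\nu)$; such $e$ is a $\nu_{SD}$-name of $A$. For $B\subseteq C\subseteq X$, $B$ is a $\nu$-semi-decidable subset of $C$ if there is $e$ such that for all $i\in\mathrm{dom}(\nu)$ with $\nu(i)\in C$: $\varphi_e(i)\downarrow\iff\nu(i)\in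 B$. One writes $A\rightsquigarrow_\nu B$ iff $B$ is not a $\nu$-semi-decidable subset of $A\cup B$. For subnumberings $\alpha,\beta$ of a set, $\alpha\le\beta$ means there is a partial computable $F$ defined on $\mathrm{dom}(\alpha)$ with $\beta(F(n))=\alpha(n)$. A Type 1 computable topological space is a quadruple $(X,\nu,\mathcal{T},\tau)$ where $\mathcal{T}$ is a topology on $X$, $\nu$ a numbering of $X$, $\tau$ a subnumbering of $\mathcal{T}$, such that: the image of $\tau$ generates $\mathcal{T}$ as a basis; $\emptyset$ and $X$ are in the image of $\tau$; $\tau\le\nu_{SD}$; there is a computable procedure which, given an index of a total computable $g$ with values in $\mathrm{dom}(\tau)$, outputs a $\tau$-name of $\bigcup_n\tau(g(n))$; and there is a computable procedure which from $\tau$-names of $O_1,O_2$ outputs a $\tau$-name of $O_1\cap O_2$. Sets in the image of $\tau$ are the effective open sets. $S^c$ denotes the complement in $X$. For $A\subseteq X$, $x$ is effectively adherent to $A$, written $x\in\overline{A}^{+}$, if there is a partial computable function which, on input any $\tau_1$-name of an open set $O$ containing $x$, outputs a $\nu$-name of a point of $O\cap A$. -}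

module Defs where

open import Level using (0ℓ)
open import Data.Nat using (ℕ; zero; suc; _+_)
open import Data.Product using (Σ; ∃; _×_; _,_; proj₁; proj₂)
open import Data.Maybe using (Maybe; just; nothing; _>>=_)
open import Data.Empty using (⊥)
open import Data.Sum using (_⊎_)
open import Relation.Nullary using (¬_)
open import Relation.Binary.PropositionalEquality using (_≡_)
open import Relation.Unary using (Pred; _⊆_)

infix 2 _⟺_
_⟺_ : ∀ {a b} → Set a → Set b → Set _
A ⟺ B = (A → B) × (B → A)

tri : ℕ → ℕ
tri zero    = zero
tri (suc k) = suc k + tri k

pair : ℕ → ℕ → ℕ
pair x y = tri (x + y) + y

-- inverse of pair, by walking the diagonals
unpair : ℕ → ℕ × ℕ
unpair zero = zero , zero
unpair (suc n) with unpair n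
... | zero  , y = suc y , zero
... | suc x , y = x , suc y

-- A concrete model of partial recursive functions ℕ ⇀ ℕ
-- (unary μ-recursive functions, with arguments combined by pairing)
--   zer x = 0, suc′ x = x+1, idc x = x,
--   fstc x = proj₁ (unpair x), sndc x = proj₂ (unpair x),
--   pairc f g x = pair (f x) (g x), compc f g x = f (g x),
--   recc f g (pair a 0) = f a,
--   recc f g (pair a (y+1)) = g (pair (pair a y) (recc f g (pair a y))),
--   muc f a = least y with f (pair a y) = 0 (all earlier values defined).

data Code : Set where
  zer suc′ idc fstc sndc : Code
  pairc compc recc : Code → Code → Code
  muc : Code → Code

mutual
  eval : ℕ → Code → ℕ → Maybe ℕ
  eval zero    _           _ = nothing
  eval (suc k) zer         x = just zero
  eval (suc k) suc′        x = just (suc x)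
  eval (suc k) idc         x = just x
  eval (suc k) fstc        x = just (proj₁ (unpair x))
  eval (suc k) sndc        x = just (proj₂ (unpair x))
  eval (suc k) (pairc f g) x =
    eval k f x >>= λ a → eval k g x >>= λ b → just (pair a b)
  eval (suc k) (compc f g) x = eval k g x >>= λ b → eval k f b
  eval (suc k) (recc f g)  x = evalRec k f g (proj₁ (unpair x)) (proj₂ (unpair x))
  eval (suc k) (muc f)     x = evalMu k f x zero

  evalRec : ℕ → Code → Code → ℕ → ℕ → Maybe ℕ
  evalRec k f g a zero    = eval k f a
  evalRec k f g a (suc y) =
    evalRec k f g a y >>= λ r → eval k g (pair (pair a y) r)

  evalMu : ℕ → Code → ℕ → ℕ → Maybe ℕ
  evalMu zero    f a y = nothing
  evalMu (suc k) f a y = eval k f (pair a y) >>= λ where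
    zero    → just y
    (suc _) → evalMu k f a (suc y)

decode′ : ℕ → ℕ → Code
decode′ zero    _ = zer
decode′ (suc k) n with unpair n
... | zero , r = zer
... | suc zero , r = suc′
... | suc (suc zero) , r = idc
... | suc (suc (suc zero)) , r = fstc
... | suc (suc (suc (suc zero))) , r = sndc
... | suc (suc (suc (suc (suc zero)))) , r =
        pairc (decode′ k (proj₁ (unpair r))) (decode′ k (proj₂ (unpair r)))
... | suc (suc (suc (suc (suc (suc zero))))) , r =
        compc (decode′ k (proj₁ (unpair r))) (decode′ k (proj₂ (unpair r)))
... | suc (suc (suc (suc (suc (suc (suc zero)))))) , r =
        recc (decode′ k (proj₁ (unpair r))) (decode′ k (proj₂ (unpair r)))
... | suc (suc (suc (suc (suc (suc (suc (suc zero))))))) , r = muc (decode′ k r)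
... | suc (suc (suc (suc (suc (suc (suc (suc (suc _)))))))) , r = zer

decode : ℕ → Code
decode n = decode′ n n

infix 4 _·_↓=_ _·_↓
_·_↓=_ : ℕ → ℕ → ℕ → Set
e · n ↓= m = ∃ λ k → eval k (decode e) n ≡ just m

_·_↓ : ℕ → ℕ → Set
e · n ↓ = ∃ λ m → e · n ↓= m

record Numbering (X : Set) : Set₁ where
  field
    _names_    : ℕ → X → Set
    functional : ∀ {n x y} → n names x → n names y → x ≡ y
    surjective : ∀ x → ∃ λ n → n names x


module _ {X : Set} (ν : Numbering X) where
  open Numbering ν using (_names_)

  SDName : ℕ → Pred X 0ℓ → Set
  SDName e A = ∀ i x → i names x → (e · i ↓ ⟺ A x)

  SDSubset : Pred X 0ℓ → Pred X 0ℓ → Set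
  SDSubset B C = ∃ λ e → ∀ i x → i names x → C x → (e · i ↓ ⟺ B x)

  Leadsto : Pred X 0ℓ → Pred X 0ℓ → Set
  Leadsto A B = ¬ SDSubset B (λ x → A x ⊎ B x)

-- Type 1 computable topological spaces
-- τ is a subnumbering of the topology: τdom is dom(τ), and for n ∈ dom(τ)
-- the open set τ(n) is the subset { x | τ n x }.

record Type1Space (X : Set) : Set₁ where
  field
    ν      : Numbering X
    T      : Pred (Pred X 0ℓ) 0ℓ
    τdom   : ℕ → Set
    τ      : ℕ → Pred X 0ℓ
    basis  : ∀ U → T U ⟺ (∀ x → U x → ∃ λ n → τdom n × τ n x × τ n ⊆ U)
    empty  : ∃ λ n → τdom n × (∀ x → ¬ τ n x)
    whole  : ∃ λ n → τdom n × (∀ x → τ n x)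
    τ≤SD   : ∃ λ c → ∀ n → τdom n → ∃ λ m → (c · n ↓= m) × SDName ν m (τ n)
    union  : ∃ λ u → ∀ e → (∀ n → ∃ λ m → (e · n ↓= m) × τdom m) →
               ∃ λ k → (u · e ↓= k) × τdom k ×
                 (∀ x → τ k x ⟺ (∃ λ n → ∃ λ m → (e · n ↓= m) × τ m x))
    inter  : ∃ λ c → ∀ a b → τdom a → τdom b →
               ∃ λ k → (c · pair a b ↓= k) × τdom k × (∀ x → τ k x ⟺ (τ a x × τ b x))

  open Numbering ν public using (_names_)

  EffAdh : X → Pred X 0ℓ → Set
  EffAdh x A = ∃ λ c → ∀ n → τdom n → τ n x →
                 ∃ λ m → (c · n ↓= m) × (∃ λ y → m names y × τ n y × A y)

  Markov : Set₁
  Markov = ∀ x (A : Pred X 0ℓ) → ¬ A x → EffAdh x A → Leadsto ν A (λ y → y ≡ x)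

Computable : ∀ {X Y : Set} → Type1Space X → Type1Space Y → (X → Y) → Set
Computable SX SY f = ∃ λ c → ∀ i x → i names₁ x → ∃ λ m → (c · i ↓= m) × m names₂ f x
  where
  open Type1Space SX renaming (_names_ to _names₁_)
  open Type1Space SY renaming (_names_ to _names₂_)

EffDiscontinuityAt : ∀ {X Y : Set} → Type1Space X → Type1Space Y → (X → Y) → X → Set
EffDiscontinuityAt SX SY f x =
  ∃ λ n → Type1Space.τdom SY n × Type1Space.τ SY n (f x) ×
    Type1Space.EffAdh SX x (λ z → ¬ Type1Space.τ SY n (f z))

{-# OPTIONS --safe #-}
-- If O is an effective open set of Y, a semi-decision procedure for O composed
-- with a program for f semi-decides f⁻¹(O).  At a point x of f⁻¹(O) that is
-- effectively adherent to A = f⁻¹(O)ᶜ, the set f⁻¹(O) meets A ∪ {x} exactly in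
-- {x}, so {x} is a ν-semi-decidable subset of A ∪ {x}, which the Markov
-- condition forbids.
module Submission where

open import Defs
open import Level using (0ℓ)
open import Relation.Nullary using (¬_)
open import Relation.Unary using (Pred)
open import Data.Product using (∃; Σ; _×_; _,_; proj₁; proj₂)
open import Data.Sum using (_⊎_; inj₁; inj₂)
open import Data.Empty using (⊥-elim)
open import Data.Nat using (ℕ; zero; suc; _+_; _≤_; _<_; z≤n; s≤s)
open import Data.Nat.Properties
open import Data.Maybe using (Maybe; just; _>>=_)
open import Data.Maybe.Properties using (just-injective)
open import Relation.Binary.PropositionalEquality
open ≡-Reasoning

unpair-diagonal : ∀ s x y → x + y ≡ s → unpair (tri s + y) ≡ (x , y)
unpair-diagonal s x (suc y) eq
  rewrite +-suc (tri s) y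
        | unpair-diagonal s (suc x) y (trans (sym (+-suc x y)) eq) = refl
unpair-diagonal zero zero zero eq = refl
unpair-diagonal zero (suc x) zero ()
unpair-diagonal (suc s) x zero eq with trans (sym (+-identityʳ x)) eq
... | refl rewrite +-identityʳ (s + tri s) | +-comm s (tri s)
                 | unpair-diagonal s 0 s refl = refl

unpair-pair : ∀ x y → unpair (pair x y) ≡ (x , y)
unpair-pair x y = unpair-diagonal (x + y) x y refl

unpair-sum-≤ : ∀ n → proj₁ (unpair n) + proj₂ (unpair n) ≤ n
unpair-sum-≤ zero = z≤n
unpair-sum-≤ (suc n) with unpair n | unpair-sum-≤ n
... | zero  , y | y≤n   = s≤s (≤-trans (≤-reflexive (+-identityʳ y)) y≤n)
... | suc x , y | 1+x+y≤n = ≤-trans (≤-reflexive (+-suc x y)) (m≤n⇒m≤1+n 1+x+y≤n)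

proj₁-unpair-≤ : ∀ n → proj₁ (unpair n) ≤ n
proj₁-unpair-≤ n = ≤-trans (m≤m+n _ _) (unpair-sum-≤ n)

proj₂-unpair-≤ : ∀ n → proj₂ (unpair n) ≤ n
proj₂-unpair-≤ n = ≤-trans (m≤n+m _ _) (unpair-sum-≤ n)

remainder-< : ∀ n → 0 < proj₁ (unpair n) → proj₂ (unpair n) < n
remainder-< n 0<tag = <-≤-trans (m<n+m _ 0<tag) (unpair-sum-≤ n)

<-≤-suc⇒≤ : ∀ {r n k} → r < n → n ≤ suc k → r ≤ k
<-≤-suc⇒≤ r<n n≤1+k = ≤-pred (<-≤-trans r<n n≤1+k)

mutual
  decode′-stable : ∀ {k j n} → n ≤ k → n ≤ j → decode′ k n ≡ decode′ j n
  decode′-stable {zero}  {zero}  _   _   = refl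
  decode′-stable {zero}  {suc j} z≤n _   = refl
  decode′-stable {suc k} {zero}  _   z≤n = refl
  decode′-stable {suc k} {suc j} {n} n≤1+k n≤1+j with unpair n | remainder-< n
  ... | zero , r | _ = refl
  ... | suc zero , r | _ = refl
  ... | suc (suc zero) , r | _ = refl
  ... | suc (suc (suc zero)) , r | _ = refl
  ... | suc (suc (suc (suc zero))) , r | _ = refl
  ... | suc (suc (suc (suc (suc zero)))) , r | r<n =
    binary-stable pairc (r<n (s≤s z≤n)) n≤1+k n≤1+j
  ... | suc (suc (suc (suc (suc (suc zero))))) , r | r<n =
    binary-stable compc (r<n (s≤s z≤n)) n≤1+k n≤1+j
  ... | suc (suc (suc (suc (suc (suc (suc zero)))))) , r | r<n =
    binary-stable recc (r<n (s≤s z≤n)) n≤1+k n≤1+j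
  ... | suc (suc (suc (suc (suc (suc (suc (suc zero))))))) , r | r<n =
    cong muc (decode′-stable (<-≤-suc⇒≤ (r<n (s≤s z≤n)) n≤1+k)
                             (<-≤-suc⇒≤ (r<n (s≤s z≤n)) n≤1+j))
  ... | suc (suc (suc (suc (suc (suc (suc (suc (suc _)))))))) , r | _ = refl

  binary-stable : ∀ (c : Code → Code → Code) {k j r n} → r < n → n ≤ suc k → n ≤ suc j →
    c (decode′ k (proj₁ (unpair r))) (decode′ k (proj₂ (unpair r))) ≡
    c (decode′ j (proj₁ (unpair r))) (decode′ j (proj₂ (unpair r)))
  binary-stable c {k} {j} {r} r<n n≤1+k n≤1+j = cong₂ c
    (decode′-stable (≤-trans (proj₁-unpair-≤ r) r≤k) (≤-trans (proj₁-unpair-≤ r) r≤j))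
    (decode′-stable (≤-trans (proj₂-unpair-≤ r) r≤k) (≤-trans (proj₂-unpair-≤ r) r≤j))
    where
    r≤k : r ≤ k
    r≤k = <-≤-suc⇒≤ r<n n≤1+k
    r≤j : r ≤ j
    r≤j = <-≤-suc⇒≤ r<n n≤1+j

decode′-compc-tag : ∀ k n {r} → unpair n ≡ (6 , r) →
  decode′ (suc k) n ≡ compc (decode′ k (proj₁ (unpair r))) (decode′ k (proj₂ (unpair r)))
decode′-compc-tag k n eq rewrite eq = refl

compCode : ℕ → ℕ → ℕ
compCode a b = pair 6 (pair a b)

decode-compCode : ∀ a b → decode (compCode a b) ≡ compc (decode a) (decode b)
decode-compCode a b = begin
  decode (compCode a b)
    ≡⟨ decode′-compc-tag fuel (pair 6 r) (unpair-pair 6 r) ⟩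
  compc (decode′ fuel (proj₁ (unpair r))) (decode′ fuel (proj₂ (unpair r)))
    ≡⟨ cong (λ p → compc (decode′ fuel (proj₁ p)) (decode′ fuel (proj₂ p))) (unpair-pair a b) ⟩
  compc (decode′ fuel a) (decode′ fuel b)
    ≡⟨ cong₂ compc (decode′-stable (≤-trans a≤r r≤fuel) ≤-refl)
                   (decode′-stable (≤-trans b≤r r≤fuel) ≤-refl) ⟩
  compc (decode a) (decode b) ∎
  where
  r : ℕ
  r = pair a b
  -- pair 6 r reduces to suc fuel, the fuel that decode uses on compCode a b.
  fuel : ℕ
  fuel = ((5 + r) + tri (5 + r)) + r
  r≤fuel : r ≤ fuel
  r≤fuel = m≤n+m r ((5 + r) + tri (5 + r))
  a≤r : a ≤ r
  a≤r = subst (_≤ r) (cong proj₁ (unpair-pair a b)) (proj₁-unpair-≤ r)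
  b≤r : b ≤ r
  b≤r = subst (_≤ r) (cong proj₂ (unpair-pair a b)) (proj₂-unpair-≤ r)

>>=-just⁻ : ∀ {A B : Set} (m : Maybe A) (h : A → Maybe B) {v} → (m >>= h) ≡ just v →
  Σ A λ a → m ≡ just a × h a ≡ just v
>>=-just⁻ (just a) h eq = a , refl , eq

mutual
  eval-suc : ∀ k c x {v} → eval k c x ≡ just v → eval (suc k) c x ≡ just v
  eval-suc (suc k) zer         x eq = eq
  eval-suc (suc k) suc′        x eq = eq
  eval-suc (suc k) idc         x eq = eq
  eval-suc (suc k) fstc        x eq = eq
  eval-suc (suc k) sndc        x eq = eq
  eval-suc (suc k) (pairc f g) x eq with >>=-just⁻ (eval k f x) _ eq
  ... | a , fx≡a , rest with >>=-just⁻ (eval k g x) _ rest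
  ... | b , gx≡b , done rewrite eval-suc k f x fx≡a | eval-suc k g x gx≡b = done
  eval-suc (suc k) (compc f g) x eq with >>=-just⁻ (eval k g x) _ eq
  ... | b , gx≡b , fb≡v rewrite eval-suc k g x gx≡b | eval-suc k f b fb≡v = refl
  eval-suc (suc k) (recc f g)  x eq = evalRec-suc k f g (proj₁ (unpair x)) (proj₂ (unpair x)) eq
  eval-suc (suc k) (muc f)     x eq = evalMu-suc k f x zero eq

  evalRec-suc : ∀ k f g a y {v} → evalRec k f g a y ≡ just v → evalRec (suc k) f g a y ≡ just v
  evalRec-suc k f g a zero    eq = eval-suc k f a eq
  evalRec-suc k f g a (suc y) eq with >>=-just⁻ (evalRec k f g a y) _ eq
  ... | r , rec≡r , step rewrite evalRec-suc k f g a y rec≡r | eval-suc k g _ step = refl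

  evalMu-suc : ∀ k f a y {v} → evalMu k f a y ≡ just v → evalMu (suc k) f a y ≡ just v
  evalMu-suc (suc k) f a y eq with >>=-just⁻ (eval k f (pair a y)) _ eq
  ... | zero  , fay≡0 , found rewrite eval-suc k f _ fay≡0 = found
  ... | suc _ , fay≢0 , later rewrite eval-suc k f _ fay≢0 = evalMu-suc k f a (suc y) later

eval-+ : ∀ k j c x {v} → eval k c x ≡ just v → eval (k + j) c x ≡ just v
eval-+ k zero    c x eq rewrite +-identityʳ k = eq
eval-+ k (suc j) c x eq rewrite +-suc k j = eval-suc (k + j) c x (eval-+ k j c x eq)

eval-+ˡ : ∀ k j c x {v} → eval j c x ≡ just v → eval (k + j) c x ≡ just v
eval-+ˡ k j c x {v} eq = subst (λ fuel → eval fuel c x ≡ just v) (+-comm j k) (eval-+ j k c x eq)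

↓=-deterministic : ∀ e {i v w} → e · i ↓= v → e · i ↓= w → v ≡ w
↓=-deterministic e {i} (k , ev) (j , ew) =
  just-injective (trans (sym (eval-+ k j (decode e) i ev)) (eval-+ˡ k j (decode e) i ew))

compCode-↓= : ∀ a b {i w v} → b · i ↓= w → a · w ↓= v → compCode a b · i ↓= v
compCode-↓= a b {i} {w} {v} (k , bi≡w) (j , aw≡v) = suc (k + j) ,
  subst (λ c → eval (suc (k + j)) c i ≡ just v) (sym (decode-compCode a b))
    (subst (λ bi → (bi >>= eval (k + j) (decode a)) ≡ just v)
       (sym (eval-+ k j (decode b) i bi≡w))
       (eval-+ˡ k j (decode a) w aw≡v))

compCode-↓=⁻ : ∀ a b {i v} → compCode a b · i ↓= v → ∃ λ w → (b · i ↓= w) × (a · w ↓= v)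
compCode-↓=⁻ a b (zero , ())
compCode-↓=⁻ a b {i} {v} (suc k , eq)
  with >>=-just⁻ (eval k (decode b) i) _
         (subst (λ c → eval (suc k) c i ≡ just v) (decode-compCode a b) eq)
... | w , bi≡w , aw≡v = w , (k , bi≡w) , (k , aw≡v)

effectiveOpen-SDName : ∀ {Y : Set} (SY : Type1Space Y) {n} → Type1Space.τdom SY n →
  ∃ λ m → SDName (Type1Space.ν SY) m (Type1Space.τ SY n)
effectiveOpen-SDName SY {n} n∈dom with proj₂ (Type1Space.τ≤SD SY) n n∈dom
... | m , _ , sd = m , sd

SDName-preimage : ∀ {X Y : Set} (SX : Type1Space X) (SY : Type1Space Y) {f : X → Y} →
  Computable SX SY f → {U : Pred Y 0ℓ} → (∃ λ m → SDName (Type1Space.ν SY) m U) →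
  ∃ λ e → SDName (Type1Space.ν SX) e (λ x → U (f x))
SDName-preimage SX SY {f} (c , c-realises-f) {U} (m , sdU) = compCode m c , decides
  where
  decides : SDName (Type1Space.ν SX) (compCode m c) (λ x → U (f x))
  decides i x i-names-x with c-realises-f i x i-names-x
  ... | b , ci≡b , b-names-fx = halts⇒U , U⇒halts
    where
    halts⇒U : compCode m c · i ↓ → U (f x)
    halts⇒U (v , halts) with compCode-↓=⁻ m c halts
    ... | w , ci≡w , mw≡v with ↓=-deterministic c ci≡b ci≡w
    ... | refl = proj₁ (sdU b (f x) b-names-fx) (v , mw≡v)

    U⇒halts : U (f x) → compCode m c · i ↓
    U⇒halts fx∈U with proj₂ (sdU b (f x) b-names-fx) fx∈U
    ... | v , mb≡v = v , compCode-↓= m c ci≡b mb≡v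

SDName⇒SDSubset : ∀ {X : Set} (ν : Numbering X) {P B C : Pred X 0ℓ} →
  (∃ λ e → SDName ν e P) → (∀ x → C x → (P x ⟺ B x)) → SDSubset ν B C
SDName⇒SDSubset ν (e , sdP) P⟺B-on-C = e , λ i x i-names-x x∈C →
  let halts⟺P = sdP i x i-names-x ; P⟺B = P⟺B-on-C x x∈C in
  (λ halts → proj₁ P⟺B (proj₁ halts⟺P halts)) , (λ b → proj₂ halts⟺P (proj₂ P⟺B b))

mainTheorem5 : ∀ {X Y : Set} (SX : Type1Space X) (SY : Type1Space Y) →
    Type1Space.Markov SX →
    (f : X → Y) → Computable SX SY f →
    ¬ (∃ λ x → EffDiscontinuityAt SX SY f x)
mainTheorem5 {X} SX SY markov f computable (x , n , n∈dom , fx∈O , x-adherent) =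
  markov x A (λ fx∉O → fx∉O fx∈O) x-adherent
    (SDName⇒SDSubset (Type1Space.ν SX) (SDName-preimage SX SY computable (effectiveOpen-SDName SY n∈dom)) O⟺x-on-A∪x)
  where
  open Type1Space SY using (τ)
  A : Pred X 0ℓ
  A z = ¬ τ n (f z)

  O⟺x-on-A∪x : ∀ z → A z ⊎ z ≡ x → τ n (f z) ⟺ z ≡ x
  O⟺x-on-A∪x z (inj₁ fz∉O) = (λ fz∈O → ⊥-elim (fz∉O fz∈O)) , λ { refl → fx∈O }
  O⟺x-on-A∪x z (inj₂ refl) = (λ _ → refl) , λ _ → fx∈O
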